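{- Let $K_{a,b}$ be the complete bipartite graph with parts of sizes $a$ and $b$, where $2\le a\le b\le 2a$. Then $$b_t^2(K_{a,b})=b.$$
   Context: $\gamma_t(K_{a,b})=2$ for $2\le a\le b$. A total dominating set of a graph without isolated vertices is a vertex set $S$ such that every vertex is adjacent to some vertex of $S$; $\gamma_t(G)$ is the minimum size of such a set. The $k$-total bondage number $b_t^k(G)$ is the minimum number of edges that must be deleted from $G$ so that the resulting graph (required to have no isolated vertices) has total domination number at least $\gamma_t(G)+k$. -}

module Defs where

open import Data.Nat using (ℕ; zero; suc; _+_; _≤_; _∸_; _<ᵇ_)
open import Data.Fin using (Fin; toℕ)
import Data.Fin as F
open import Data.Bool using (Bool; true; false; _xor_; _∧_)
open import Data.Fin.Subset using (Subset; _∈_; ∣_∣)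
open import Data.Product using (Σ; ∃; _×_; _,_)
open import Relation.Binary.PropositionalEquality using (_≡_)

record SimpleGraph (n : ℕ) : Set where
  field
    adj    : Fin n → Fin n → Bool
    sym    : ∀ i j → adj i j ≡ adj j i
    irrefl : ∀ i → adj i i ≡ false
open SimpleGraph public

boolℕ : Bool → ℕ
boolℕ true  = 1
boolℕ false = 0

sumFin : (n : ℕ) → (Fin n → ℕ) → ℕ
sumFin zero    f = 0
sumFin (suc n) f = f F.zero + sumFin n (λ i → f (F.suc i))

edgeCount : ∀ {n} → SimpleGraph n → ℕ
edgeCount {n} G =
  sumFin n (λ i → sumFin n (λ j → boolℕ ((toℕ i <ᵇ toℕ j) ∧ adj G i j)))

SpanningSubgraph : ∀ {n} → SimpleGraph n → SimpleGraph n → Set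
SpanningSubgraph H G = ∀ i j → adj H i j ≡ true → adj G i j ≡ true

deletedEdges : ∀ {n} → SimpleGraph n → SimpleGraph n → ℕ
deletedEdges G H = edgeCount G ∸ edgeCount H

NoIsolated : ∀ {n} → SimpleGraph n → Set
NoIsolated {n} G = ∀ (v : Fin n) → ∃ λ u → adj G v u ≡ true

TotalDominating : ∀ {n} → SimpleGraph n → Subset n → Set
TotalDominating {n} G S = ∀ (v : Fin n) → ∃ λ u → u ∈ S × adj G v u ≡ true

IsTotalDominationNumber : ∀ {n} → SimpleGraph n → ℕ → Set
IsTotalDominationNumber {n} G γ =
  (∃ λ (S : Subset n) → TotalDominating G S × ∣ S ∣ ≡ γ)
  × (∀ (S : Subset n) → TotalDominating G S → γ ≤ ∣ S ∣)

KBondageCandidate : ∀ {n} → SimpleGraph n → ℕ → ℕ → SimpleGraph n → Set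
KBondageCandidate G γ k H =
  SpanningSubgraph H G × NoIsolated H
  × (∀ γ' → IsTotalDominationNumber H γ' → γ + k ≤ γ')

IsKTotalBondageNumber : ∀ {n} → SimpleGraph n → ℕ → ℕ → Set
IsKTotalBondageNumber {n} G k β =
  Σ ℕ λ γ → IsTotalDominationNumber G γ
  × (∃ λ (H : SimpleGraph n) → KBondageCandidate G γ k H × deletedEdges G H ≡ β)
  × (∀ (H : SimpleGraph n) → KBondageCandidate G γ k H → β ≤ deletedEdges G H)

-- Complete bipartite graph K_{a,b}: vertices 0..a-1 form one part,
-- vertices a..a+b-1 the other.
side : ∀ {a b} → Fin (a + b) → Bool
side {a} i = toℕ i <ᵇ a

private
  xor-comm : ∀ x y → (x xor y) ≡ (y xor x)
  xor-comm true true = Relation.Binary.PropositionalEquality.refl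
  xor-comm true false = Relation.Binary.PropositionalEquality.refl
  xor-comm false true = Relation.Binary.PropositionalEquality.refl
  xor-comm false false = Relation.Binary.PropositionalEquality.refl
  xor-self : ∀ x → (x xor x) ≡ false
  xor-self true = Relation.Binary.PropositionalEquality.refl
  xor-self false = Relation.Binary.PropositionalEquality.refl

K : (a b : ℕ) → SimpleGraph (a + b)
K a b = record
  { adj    = λ i j → side {a} {b} i xor side {a} {b} j
  ; sym    = λ i j → xor-comm (side {a} {b} i) (side {a} {b} j)
  ; irrefl = λ i → xor-self (side {a} {b} i)
  }

-- Removing fewer than b edges from K_{a,b} leaves a right vertex adjacent to every left vertex and,
-- because b ≤ 2a, a left vertex with at most one non-neighbour; these two vertices together with a
-- neighbour of that non-neighbour form a total dominating set of size at most 3.  Conversely, removing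
-- the b edges joining each right vertex j to the left vertex min(j, a - 1) leaves every vertex with a
-- non-neighbour on the other side; then each vertex v is dominated by some y, a non-neighbour of y is
-- dominated by some y' ≠ y on the same side, and applying this on both sides gives four distinct
-- vertices in any total dominating set.

module Submission where

open import Defs hiding (sym)
open import Data.Nat using (ℕ; zero; suc; _+_; _*_; _∸_; _≤_; _<_; _<ᵇ_; _≡ᵇ_; _⊓_; z≤n; s≤s; s≤s⁻¹)
open import Data.Nat.Properties
open import Data.Fin as F using (Fin; toℕ; _↑ˡ_; _↑ʳ_; splitAt; fromℕ<)
import Data.Fin.Properties as FP
open import Data.Bool using (Bool; true; false; not; _∧_; _xor_)
import Data.Bool as B
open import Data.Bool.Properties using (not-involutive; not-¬; ∧-zeroʳ; T-≡)
open import Data.Fin.Subset using (Subset; _∈_; ∣_∣; ⁅_⁆; _∪_; ⊥; inside; outside)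
import Data.Fin.Subset.Properties as SP
open import Data.List using (List; []; _∷_; length)
open import Data.List.Membership.Propositional renaming (_∈_ to _∈ₗ_)
open import Data.List.Relation.Unary.Any using (here; there)
open import Data.List.Relation.Unary.All as All using (All; []; _∷_)
open import Data.List.Relation.Unary.AllPairs using ([]; _∷_)
open import Data.List.Relation.Unary.Unique.Propositional using (Unique)
open import Data.Product using (∃; ∃₂; _×_; _,_)
open import Data.Sum using (_⊎_; inj₁; inj₂)
open import Data.Vec using ([]; _∷_)
open import Data.Empty using (⊥-elim)
open import Function using (_∘_; Equivalence)
open import Relation.Nullary using (¬_; Dec; yes; no)
open import Relation.Nullary.Decidable using (_×-dec_)
open import Relation.Unary using (Decidable)
open import Relation.Binary.PropositionalEquality
open import Algebra.Properties.CommutativeMonoid.Sum +-0-commutativeMonoid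
  using (sum; sum-cong-≗; ∑-distrib-+; ∑-comm)

xor≡true⇒≡not : ∀ {x y} → x xor y ≡ true → y ≡ not x
xor≡true⇒≡not {true}  {false} _ = refl
xor≡true⇒≡not {false} {true}  _ = refl

∧≡true⇒ˡ : ∀ {x y} → x ∧ y ≡ true → x ≡ true
∧≡true⇒ˡ {true} _ = refl

boolℕ-not≤0 : ∀ {h} → boolℕ (not h) ≤ 0 → h ≡ true
boolℕ-not≤0 {true} _ = refl

boolℕ-∧-split : ∀ c g h → (h ≡ true → g ≡ true) →
  boolℕ (c ∧ g) ≡ boolℕ (c ∧ h) + boolℕ (c ∧ g ∧ not h)
boolℕ-∧-split false g     h     _   = refl
boolℕ-∧-split true  true  true  _   = refl
boolℕ-∧-split true  true  false _   = refl
boolℕ-∧-split true  false true  h⇒g with () ← h⇒g refl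
boolℕ-∧-split true  false false _   = refl

sumFin≡sum : ∀ n (f : Fin n → ℕ) → sumFin n f ≡ sum f
sumFin≡sum zero    f = refl
sumFin≡sum (suc n) f = cong (f F.zero +_) (sumFin≡sum n (f ∘ F.suc))

sumFin-cong : ∀ n {f g : Fin n → ℕ} → (∀ i → f i ≡ g i) → sumFin n f ≡ sumFin n g
sumFin-cong n {f} {g} f≗g = begin
  sumFin n f ≡⟨ sumFin≡sum n f ⟩
  sum f      ≡⟨ sum-cong-≗ f≗g ⟩
  sum g      ≡⟨ sumFin≡sum n g ⟨
  sumFin n g ∎
  where open ≡-Reasoning

sumFin-distrib-+ : ∀ n (f g : Fin n → ℕ) →
  sumFin n (λ i → f i + g i) ≡ sumFin n f + sumFin n g
sumFin-distrib-+ n f g = begin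
  sumFin n (λ i → f i + g i) ≡⟨ sumFin≡sum n _ ⟩
  sum (λ i → f i + g i)      ≡⟨ ∑-distrib-+ f g ⟩
  sum f + sum g              ≡⟨ cong₂ _+_ (sumFin≡sum n f) (sumFin≡sum n g) ⟨
  sumFin n f + sumFin n g    ∎
  where open ≡-Reasoning

sumFin-comm : ∀ m n (f : Fin m → Fin n → ℕ) →
  sumFin m (λ i → sumFin n (f i)) ≡ sumFin n (λ j → sumFin m (λ i → f i j))
sumFin-comm m n f = begin
  sumFin m (λ i → sumFin n (f i))         ≡⟨ sumFin-cong m (λ i → sumFin≡sum n (f i)) ⟩
  sumFin m (λ i → sum (f i))              ≡⟨ sumFin≡sum m _ ⟩
  sum (λ i → sum (f i))                   ≡⟨ ∑-comm f ⟩
  sum (λ j → sum (λ i → f i j))           ≡⟨ sumFin≡sum n _ ⟨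
  sumFin n (λ j → sum (λ i → f i j))      ≡⟨ sumFin-cong n (λ j → sumFin≡sum m _) ⟨
  sumFin n (λ j → sumFin m (λ i → f i j)) ∎
  where open ≡-Reasoning

sumFin-const : ∀ n c → sumFin n (λ _ → c) ≡ n * c
sumFin-const zero    c = refl
sumFin-const (suc n) c = cong (c +_) (sumFin-const n c)

sumFin-zero : ∀ n {f : Fin n → ℕ} → (∀ i → f i ≡ 0) → sumFin n f ≡ 0
sumFin-zero n f≗0 = trans (sumFin-cong n f≗0) (trans (sumFin-const n 0) (*-zeroʳ n))

sumFin-splitAt : ∀ m n (f : Fin (m + n) → ℕ) →
  sumFin (m + n) f ≡ sumFin m (f ∘ (_↑ˡ n)) + sumFin n (f ∘ (m ↑ʳ_))
sumFin-splitAt zero    n f = refl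
sumFin-splitAt (suc m) n f =
  trans (cong (f F.zero +_) (sumFin-splitAt m n (f ∘ F.suc))) (sym (+-assoc (f F.zero) _ _))

term≤sumFin : ∀ n (f : Fin n → ℕ) i → f i ≤ sumFin n f
term≤sumFin (suc n) f F.zero    = m≤m+n _ _
term≤sumFin (suc n) f (F.suc i) = ≤-trans (term≤sumFin n (f ∘ F.suc) i) (m≤n+m _ _)

pair≤sumFin : ∀ n (f : Fin n → ℕ) {i j} → i ≢ j → f i + f j ≤ sumFin n f
pair≤sumFin (suc n) f {F.zero}  {F.zero}  i≢j = ⊥-elim (i≢j refl)
pair≤sumFin (suc n) f {F.zero}  {F.suc j} _   = +-monoʳ-≤ (f F.zero) (term≤sumFin n (f ∘ F.suc) j)
pair≤sumFin (suc n) f {F.suc i} {F.zero}  _   =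
  subst (_≤ sumFin (suc n) f) (+-comm (f F.zero) (f (F.suc i)))
        (+-monoʳ-≤ (f F.zero) (term≤sumFin n (f ∘ F.suc) i))
pair≤sumFin (suc n) f {F.suc i} {F.suc j} i≢j =
  ≤-trans (pair≤sumFin n (f ∘ F.suc) (i≢j ∘ cong F.suc)) (m≤n+m _ _)

*≤sumFin : ∀ n {m} (f : Fin n → ℕ) → (∀ i → m ≤ f i) → n * m ≤ sumFin n f
*≤sumFin zero    f _     = z≤n
*≤sumFin (suc n) f m≤f = +-mono-≤ (m≤f F.zero) (*≤sumFin n (f ∘ F.suc) (m≤f ∘ F.suc))

sumFin<⇒∃term≤ : ∀ n k (f : Fin n → ℕ) → sumFin n f < n * suc k → ∃ λ i → f i ≤ k
sumFin<⇒∃term≤ n k f small with FP.any? (λ i → f i ≤? k)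
... | yes found = found
... | no  none  = ⊥-elim (<⇒≱ small (*≤sumFin n f (λ i → ≰⇒> (λ fi≤k → none (i , fi≤k)))))

sumFin-toℕ≡ᵇ : ∀ n c → c < n → sumFin n (λ i → boolℕ (toℕ i ≡ᵇ c)) ≡ 1
sumFin-toℕ≡ᵇ (suc n) zero    _   = cong suc (sumFin-zero n (λ _ → refl))
sumFin-toℕ≡ᵇ (suc n) (suc c) c<n = sumFin-toℕ≡ᵇ n c (s≤s⁻¹ c<n)

∣p∪q∣≤∣p∣+∣q∣ : ∀ {n} (p q : Subset n) → ∣ p ∪ q ∣ ≤ ∣ p ∣ + ∣ q ∣
∣p∪q∣≤∣p∣+∣q∣ []           []           = z≤n
∣p∪q∣≤∣p∣+∣q∣ (inside ∷ p)  (inside ∷ q)  =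
  s≤s (≤-trans (∣p∪q∣≤∣p∣+∣q∣ p q) (+-monoʳ-≤ ∣ p ∣ (n≤1+n _)))
∣p∪q∣≤∣p∣+∣q∣ (inside ∷ p)  (outside ∷ q) = s≤s (∣p∪q∣≤∣p∣+∣q∣ p q)
∣p∪q∣≤∣p∣+∣q∣ (outside ∷ p) (inside ∷ q)  =
  subst (suc ∣ p ∪ q ∣ ≤_) (sym (+-suc ∣ p ∣ ∣ q ∣)) (s≤s (∣p∪q∣≤∣p∣+∣q∣ p q))
∣p∪q∣≤∣p∣+∣q∣ (outside ∷ p) (outside ∷ q) = ∣p∪q∣≤∣p∣+∣q∣ p q

fromList : ∀ {n} → List (Fin n) → Subset n
fromList []       = ⊥
fromList (x ∷ xs) = ⁅ x ⁆ ∪ fromList xs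

∈fromList : ∀ {n} {x : Fin n} {xs} → x ∈ₗ xs → x ∈ fromList xs
∈fromList (here refl) = SP.x∈p∪q⁺ (inj₁ (SP.x∈⁅x⁆ _))
∈fromList (there x∈xs) = SP.x∈p∪q⁺ (inj₂ (∈fromList x∈xs))

∣fromList∣≤length : ∀ {n} (xs : List (Fin n)) → ∣ fromList xs ∣ ≤ length xs
∣fromList∣≤length {n} []       = ≤-reflexive (SP.∣⊥∣≡0 n)
∣fromList∣≤length     (x ∷ xs) = begin
  ∣ ⁅ x ⁆ ∪ fromList xs ∣         ≤⟨ ∣p∪q∣≤∣p∣+∣q∣ ⁅ x ⁆ (fromList xs) ⟩
  ∣ ⁅ x ⁆ ∣ + ∣ fromList xs ∣      ≡⟨ cong (_+ ∣ fromList xs ∣) (SP.∣⁅x⁆∣≡1 x) ⟩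
  suc ∣ fromList xs ∣              ≤⟨ s≤s (∣fromList∣≤length xs) ⟩
  suc (length xs)                  ∎
  where open ≤-Reasoning

length≤∣p∣ : ∀ {n} {p : Subset n} {xs} → Unique xs → All (_∈ p) xs → length xs ≤ ∣ p ∣
length≤∣p∣ []             []          = z≤n
length≤∣p∣ (x≢xs ∷ unique) (x∈p ∷ xs⊆p) =
  ≤-trans (s≤s (length≤∣p∣ unique xs⊆p-x)) (SP.x∈p⇒∣p-x∣<∣p∣ x∈p)
  where
  xs⊆p-x = All.zipWith (λ (x≢y , y∈p) → SP.x∈p∧x≢y⇒x∈p-y y∈p (x≢y ∘ sym)) (x≢xs , xs⊆p)

totalDominating? : ∀ {n} (G : SimpleGraph n) (S : Subset n) → Dec (TotalDominating G S)
totalDominating? G S = FP.all? (λ v → FP.any? (λ u → (u SP.∈? S) ×-dec (adj G v u B.≟ true)))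

minimalSubset : ∀ {n} {P : Subset n → Set} → Decidable P → ∀ {S} → P S →
  ∃ λ T → P T × (∀ U → P U → ∣ T ∣ ≤ ∣ U ∣)
minimalSubset {P = P} P? {S} pS = descend ∣ S ∣ S ≤-refl pS
  where
  descend : ∀ k S → ∣ S ∣ ≤ k → P S → ∃ λ T → P T × (∀ U → P U → ∣ T ∣ ≤ ∣ U ∣)
  descend k S ∣S∣≤k pS with SP.anySubset? (λ U → P? U ×-dec (suc ∣ U ∣ ≤? ∣ S ∣))
  ... | no  ∄smaller = S , pS , λ U pU → ≮⇒≥ (λ U<S → ∄smaller (U , pU , U<S))
  descend zero    S ∣S∣≤0 pS | yes (U , _ , U<S) = ⊥-elim (<⇒≱ U<S (≤-trans ∣S∣≤0 z≤n))
  descend (suc k) S ∣S∣≤k pS | yes (U , pU , U<S) = descend k U (s≤s⁻¹ (≤-trans U<S ∣S∣≤k)) pU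

totalDominationNumber-≤ : ∀ {n} (G : SimpleGraph n) {S} → TotalDominating G S →
  ∃ λ γ → IsTotalDominationNumber G γ × γ ≤ ∣ S ∣
totalDominationNumber-≤ G {S} dom with minimalSubset (totalDominating? G) dom
... | T , domT , minimal = ∣ T ∣ , ((T , domT , refl) , minimal) , minimal S dom

2≤∣totalDominating∣ : ∀ {n} (G : SimpleGraph n) → Fin n → ∀ S → TotalDominating G S → 2 ≤ ∣ S ∣
2≤∣totalDominating∣ G v S dom with dom v
... | y , y∈S , _ with dom y
...   | x , x∈S , y~x = length≤∣p∣ ((y≢x ∷ []) ∷ [] ∷ []) (y∈S ∷ x∈S ∷ [])
  where
  y≢x : y ≢ x
  y≢x refl with () ← trans (sym y~x) (irrefl G y)

module Bipartite {n} (H : SimpleGraph n) (s : Fin n → Bool)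
  (crossing : ∀ x y → adj H x y ≡ true → s y ≡ not (s x))
  (nonNeighbour : ∀ y → ∃ λ x → s x ≡ not (s y) × adj H x y ≡ false) where

  opposite-dominators : ∀ S → TotalDominating H S → ∀ v →
    ∃₂ λ y y' → y ∈ S × y' ∈ S × y ≢ y' × s y ≡ not (s v) × s y' ≡ not (s v)
  opposite-dominators S dom v with dom v
  ... | y , y∈S , v~y with nonNeighbour y
  ...   | x , sx , x≁y with dom x
  ...     | y' , y'∈S , x~y' = y , y' , y∈S , y'∈S , y≢y' , crossing v y v~y , sy'
    where
    y≢y' : y ≢ y'
    y≢y' refl with () ← trans (sym x≁y) x~y'
    sy' : s y' ≡ not (s v)
    sy' = begin
      s y'             ≡⟨ crossing x y' x~y' ⟩
      not (s x)        ≡⟨ cong not sx ⟩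
      not (not (s y))  ≡⟨ not-involutive (s y) ⟩
      s y              ≡⟨ crossing v y v~y ⟩
      not (s v)        ∎
      where open ≡-Reasoning

  4≤∣totalDominating∣ : Fin n → ∀ S → TotalDominating H S → 4 ≤ ∣ S ∣
  4≤∣totalDominating∣ v S dom with opposite-dominators S dom v
  ... | y₁ , y₂ , y₁∈S , y₂∈S , y₁≢y₂ , sy₁ , sy₂ with opposite-dominators S dom y₁
  ...   | x₁ , x₂ , x₁∈S , x₂∈S , x₁≢x₂ , sx₁ , sx₂ =
    length≤∣p∣
      ( (y₁≢y₂ ∷ apart sy₁ sx₁ ∷ apart sy₁ sx₂ ∷ [])
      ∷ (apart sy₂ sx₁ ∷ apart sy₂ sx₂ ∷ [])
      ∷ (x₁≢x₂ ∷ [])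
      ∷ [] ∷ [])
      (y₁∈S ∷ y₂∈S ∷ x₁∈S ∷ x₂∈S ∷ [])
    where
    apart : ∀ {y x} → s y ≡ not (s v) → s x ≡ not (s y₁) → y ≢ x
    apart sy sx refl = not-¬ (trans sx (trans (cong not sy₁) (not-involutive _))) sy

deletedPair : ∀ {n} → SimpleGraph n → SimpleGraph n → Fin n → Fin n → ℕ
deletedPair G H x y = boolℕ ((toℕ x <ᵇ toℕ y) ∧ adj G x y ∧ not (adj H x y))

deletedEdges-spanning : ∀ {n} (G H : SimpleGraph n) → SpanningSubgraph H G →
  deletedEdges G H ≡ sumFin n (λ x → sumFin n (deletedPair G H x))
deletedEdges-spanning {n} G H H⊆G =
  trans (cong (_∸ edgeCount H) edgeCount-G) (m+n∸m≡n (edgeCount H) _)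
  where
  open ≡-Reasoning
  edgeH : Fin n → Fin n → ℕ
  edgeH x y = boolℕ ((toℕ x <ᵇ toℕ y) ∧ adj H x y)
  edgeCount-G : edgeCount G ≡ edgeCount H + sumFin n (λ x → sumFin n (deletedPair G H x))
  edgeCount-G = begin
    edgeCount G
      ≡⟨ sumFin-cong n (λ x → sumFin-cong n (λ y →
           boolℕ-∧-split (toℕ x <ᵇ toℕ y) (adj G x y) (adj H x y) (H⊆G x y))) ⟩
    sumFin n (λ x → sumFin n (λ y → edgeH x y + deletedPair G H x y))
      ≡⟨ sumFin-cong n (λ x → sumFin-distrib-+ n (edgeH x) (deletedPair G H x)) ⟩
    sumFin n (λ x → sumFin n (edgeH x) + sumFin n (deletedPair G H x))
      ≡⟨ sumFin-distrib-+ n _ _ ⟩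
    edgeCount H + sumFin n (λ x → sumFin n (deletedPair G H x)) ∎

removeEdges : ∀ {n} (G : SimpleGraph n) (R : Fin n → Fin n → Bool) →
  (∀ x y → R x y ≡ R y x) → SimpleGraph n
removeEdges G R R-sym = record
  { adj    = λ x y → adj G x y ∧ not (R x y)
  ; sym    = λ x y → cong₂ (λ g r → g ∧ not r) (SimpleGraph.sym G x y) (R-sym x y)
  ; irrefl = λ x → cong (_∧ not (R x x)) (irrefl G x)
  }

removeEdges-spanning : ∀ {n} (G : SimpleGraph n) R R-sym → SpanningSubgraph (removeEdges G R R-sym) G
removeEdges-spanning G R R-sym x y = ∧≡true⇒ˡ

data Part (a b : ℕ) : Fin (a + b) → Set where
  left  : (i : Fin a) → Part a b (i ↑ˡ b)
  right : (j : Fin b) → Part a b (a ↑ʳ j)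

part : ∀ a b (v : Fin (a + b)) → Part a b v
part zero    b v         = right v
part (suc a) b F.zero    = left F.zero
part (suc a) b (F.suc v) with part a b v
... | left i  = left (F.suc i)
... | right j = right j

side-↑ˡ : ∀ {a} b (i : Fin a) → side {a} {b} (i ↑ˡ b) ≡ true
side-↑ˡ b F.zero    = refl
side-↑ˡ b (F.suc i) = side-↑ˡ b i

side-↑ʳ : ∀ a {b} (j : Fin b) → side {a} {b} (a ↑ʳ j) ≡ false
side-↑ʳ zero    j = refl
side-↑ʳ (suc a) j = side-↑ʳ a j

↑ˡ<ᵇ↑ʳ : ∀ {a b} (i : Fin a) (j : Fin b) → (toℕ (i ↑ˡ b) <ᵇ toℕ (a ↑ʳ j)) ≡ true
↑ˡ<ᵇ↑ʳ F.zero    j = refl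
↑ˡ<ᵇ↑ʳ (F.suc i) j = ↑ˡ<ᵇ↑ʳ i j

↑ʳ≮ᵇ↑ˡ : ∀ {a b} (i : Fin a) (j : Fin b) → (toℕ (a ↑ʳ j) <ᵇ toℕ (i ↑ˡ b)) ≡ false
↑ʳ≮ᵇ↑ˡ F.zero    j = refl
↑ʳ≮ᵇ↑ˡ (F.suc i) j = ↑ʳ≮ᵇ↑ˡ i j

nonEdge : ∀ {a b} → SimpleGraph (a + b) → Fin a → Fin b → ℕ
nonEdge {a} {b} H i j = boolℕ (not (adj H (i ↑ˡ b) (a ↑ʳ j)))

crossNonEdges : ∀ a b → SimpleGraph (a + b) → ℕ
crossNonEdges a b H = sumFin a (λ i → sumFin b (nonEdge H i))

module _ {a b : ℕ} where

  K-adj-↑ˡ-↑ʳ : ∀ i j → adj (K a b) (i ↑ˡ b) (a ↑ʳ j) ≡ true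
  K-adj-↑ˡ-↑ʳ i j rewrite side-↑ˡ b i | side-↑ʳ a j = refl

  K-adj-↑ʳ-↑ˡ : ∀ i j → adj (K a b) (a ↑ʳ j) (i ↑ˡ b) ≡ true
  K-adj-↑ʳ-↑ˡ i j rewrite side-↑ˡ b i | side-↑ʳ a j = refl

  K-adj-↑ˡ-↑ˡ : ∀ i i' → adj (K a b) (i ↑ˡ b) (i' ↑ˡ b) ≡ false
  K-adj-↑ˡ-↑ˡ i i' rewrite side-↑ˡ b i | side-↑ˡ b i' = refl

  K-adj-↑ʳ-↑ʳ : ∀ j j' → adj (K a b) (a ↑ʳ j) (a ↑ʳ j') ≡ false
  K-adj-↑ʳ-↑ʳ j j' rewrite side-↑ʳ a j | side-↑ʳ a j' = refl

  subgraphK-crossing : ∀ (H : SimpleGraph (a + b)) → SpanningSubgraph H (K a b) →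
    ∀ x y → adj H x y ≡ true → side {a} {b} y ≡ not (side {a} {b} x)
  subgraphK-crossing H H⊆K x y x~y = xor≡true⇒≡not (H⊆K x y x~y)

  deletedEdges-K : ∀ H → SpanningSubgraph H (K a b) → deletedEdges (K a b) H ≡ crossNonEdges a b H
  deletedEdges-K H H⊆K = begin
    deletedEdges (K a b) H
      ≡⟨ deletedEdges-spanning (K a b) H H⊆K ⟩
    sumFin (a + b) (λ x → sumFin (a + b) (deleted x))
      ≡⟨ sumFin-splitAt a b _ ⟩
    sumFin a (λ i → sumFin (a + b) (deleted (i ↑ˡ b)))
      + sumFin b (λ j → sumFin (a + b) (deleted (a ↑ʳ j)))
      ≡⟨ cong₂ _+_ (sumFin-cong a fromLeft) (sumFin-zero b fromRight) ⟩
    crossNonEdges a b H + 0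
      ≡⟨ +-identityʳ _ ⟩
    crossNonEdges a b H ∎
    where
    open ≡-Reasoning
    deleted = deletedPair (K a b) H
    fromLeft : ∀ i → sumFin (a + b) (deleted (i ↑ˡ b)) ≡ sumFin b (nonEdge H i)
    fromLeft i = trans (sumFin-splitAt a b _)
      (cong₂ _+_ (sumFin-zero a leftLeft) (sumFin-cong b leftRight))
      where
      leftLeft : ∀ i' → deleted (i ↑ˡ b) (i' ↑ˡ b) ≡ 0
      leftLeft i' rewrite K-adj-↑ˡ-↑ˡ i i' | ∧-zeroʳ (toℕ (i ↑ˡ b) <ᵇ toℕ (i' ↑ˡ b)) = refl
      leftRight : ∀ j → deleted (i ↑ˡ b) (a ↑ʳ j) ≡ nonEdge H i j
      leftRight j rewrite K-adj-↑ˡ-↑ʳ i j | ↑ˡ<ᵇ↑ʳ i j = refl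
    fromRight : ∀ j → sumFin (a + b) (deleted (a ↑ʳ j)) ≡ 0
    fromRight j = trans (sumFin-splitAt a b _)
      (cong₂ _+_ (sumFin-zero a rightLeft) (sumFin-zero b rightRight))
      where
      rightLeft : ∀ i → deleted (a ↑ʳ j) (i ↑ˡ b) ≡ 0
      rightLeft i rewrite ↑ʳ≮ᵇ↑ˡ i j = refl
      rightRight : ∀ j' → deleted (a ↑ʳ j) (a ↑ʳ j') ≡ 0
      rightRight j' rewrite K-adj-↑ʳ-↑ʳ j j' | ∧-zeroʳ (toℕ (a ↑ʳ j) <ᵇ toℕ (a ↑ʳ j')) = refl

γt-K : ∀ {a b} → Fin a → Fin b → IsTotalDominationNumber (K a b) 2
γt-K {a} {b} i j = (S , dom , ≤-antisym (∣fromList∣≤length (u ∷ v ∷ [])) (2≤ S dom)) , 2≤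
  where
  u = i ↑ˡ b
  v = a ↑ʳ j
  S = fromList (u ∷ v ∷ [])
  ∈S : ∀ {x} → x ∈ₗ u ∷ v ∷ [] → x ∈ S
  ∈S = ∈fromList
  2≤ = 2≤∣totalDominating∣ (K a b) u
  dom : TotalDominating (K a b) S
  dom x with part a b x
  ... | left i'  = v , ∈S (there (here refl)) , K-adj-↑ˡ-↑ʳ i' j
  ... | right j' = u , ∈S (here refl) , K-adj-↑ʳ-↑ˡ i j'

module _ {a b : ℕ} (H : SimpleGraph (a + b)) where

  fullRightVertex : crossNonEdges a b H < b → ∃ λ j → ∀ i → adj H (i ↑ˡ b) (a ↑ʳ j) ≡ true
  fullRightVertex few with sumFin<⇒∃term≤ b 0 (λ j → sumFin a (λ i → nonEdge H i j)) fewByColumns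
    where
    fewByColumns : sumFin b (λ j → sumFin a (λ i → nonEdge H i j)) < b * 1
    fewByColumns = subst₂ _<_ (sumFin-comm a b (nonEdge H)) (sym (*-identityʳ b)) few
  ... | j , column≤0 =
    j , λ i → boolℕ-not≤0 (≤-trans (term≤sumFin a (λ i → nonEdge H i j) i) column≤0)

  nearlyFullLeftVertex : Fin b → crossNonEdges a b H < a * 2 →
    ∃₂ λ i j₀ → ∀ j → adj H (i ↑ˡ b) (a ↑ʳ j) ≡ false → j ≡ j₀
  nearlyFullLeftVertex default few with sumFin<⇒∃term≤ a 1 (λ i → sumFin b (nonEdge H i)) few
  ... | i , row≤1 with FP.any? (λ j → adj H (i ↑ˡ b) (a ↑ʳ j) B.≟ false)
  ...   | no  none         = i , default , λ j i≁j → ⊥-elim (none (j , i≁j))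
  ...   | yes (j₀ , i≁j₀) = i , j₀ , onlyNonNeighbour
    where
    onlyNonNeighbour : ∀ j → adj H (i ↑ˡ b) (a ↑ʳ j) ≡ false → j ≡ j₀
    onlyNonNeighbour j i≁j with j F.≟ j₀
    ... | yes j≡j₀ = j≡j₀
    ... | no  j≢j₀ = ⊥-elim (<-irrefl refl (≤-trans 2≤row row≤1))
      where
      2≤row : 2 ≤ sumFin b (nonEdge H i)
      2≤row = subst₂ (λ p q → p + q ≤ sumFin b (nonEdge H i))
                (cong (boolℕ ∘ not) i≁j) (cong (boolℕ ∘ not) i≁j₀)
                (pair≤sumFin b (nonEdge H i) j≢j₀)

  smallTotalDominatingSet : NoIsolated H → ∀ {i j* j₀} →
    (∀ i' → adj H (i' ↑ˡ b) (a ↑ʳ j*) ≡ true) →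
    (∀ j → adj H (i ↑ˡ b) (a ↑ʳ j) ≡ false → j ≡ j₀) →
    ∃ λ S → TotalDominating H S × ∣ S ∣ ≤ 3
  smallTotalDominatingSet noIsolated {i} {j*} {j₀} full nearlyFull with noIsolated (a ↑ʳ j₀)
  ... | w , j₀~w = S , dom , ∣fromList∣≤length members
    where
    members = (i ↑ˡ b) ∷ (a ↑ʳ j*) ∷ w ∷ []
    S = fromList members
    ∈S : ∀ {x} → x ∈ₗ members → x ∈ S
    ∈S = ∈fromList
    dom : TotalDominating H S
    dom x with part a b x
    ... | left i' = a ↑ʳ j* , ∈S (there (here refl)) , full i'
    ... | right j with adj H (i ↑ˡ b) (a ↑ʳ j) in i~j
    ...   | true  = i ↑ˡ b , ∈S (here refl) , trans (SimpleGraph.sym H _ _) i~j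
    ...   | false with refl ← nearlyFull j i~j = w , ∈S (there (there (here refl))) , j₀~w

  fewDeletions⇒γt≤3 : b ≤ 2 * a → NoIsolated H → crossNonEdges a b H < b →
    ∃ λ S → TotalDominating H S × ∣ S ∣ ≤ 3
  fewDeletions⇒γt≤3 b≤2a noIsolated few with fullRightVertex few
  ... | j* , full
    with nearlyFullLeftVertex j* (<-≤-trans few (≤-trans b≤2a (≤-reflexive (*-comm 2 a))))
  ...   | i , j₀ , nearlyFull = smallTotalDominatingSet noIsolated full nearlyFull

bondage-lower : ∀ {a b} → b ≤ 2 * a → ∀ H → KBondageCandidate (K a b) 2 2 H →
  b ≤ deletedEdges (K a b) H
bondage-lower {a} {b} b≤2a H (H⊆K , noIsolated , γt≥4) =
  subst (b ≤_) (sym (deletedEdges-K {a} {b} H H⊆K)) (≮⇒≥ fewDeletions-impossible)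
  where
  fewDeletions-impossible : ¬ crossNonEdges a b H < b
  fewDeletions-impossible few with fewDeletions⇒γt≤3 H b≤2a noIsolated few
  ... | S , dom , ∣S∣≤3 with totalDominationNumber-≤ H dom
  ...   | γ , isγ , γ≤∣S∣ = <-irrefl refl (≤-trans (γt≥4 γ isγ) (≤-trans γ≤∣S∣ ∣S∣≤3))

module Construction (a₁ b₁ : ℕ) (a≤b : suc (suc a₁) ≤ suc (suc b₁)) where

  a b : ℕ
  a = suc (suc a₁)
  b = suc (suc b₁)

  partner : Fin b → ℕ
  partner j = toℕ j ⊓ suc a₁

  partner<a : ∀ j → partner j < a
  partner<a j = s≤s (m⊓n≤n (toℕ j) (suc a₁))

  paired : Fin a → Fin b → Bool
  paired i j = toℕ i ≡ᵇ partner j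

  paired-≡ : ∀ {i j} → toℕ i ≡ partner j → paired i j ≡ true
  paired-≡ {i} {j} eq = Equivalence.to T-≡ (≡⇒≡ᵇ (toℕ i) (partner j) eq)

  pairedLeft : ∀ j → ∃ λ i → paired i j ≡ true
  pairedLeft j = fromℕ< (partner<a j) , paired-≡ (FP.toℕ-fromℕ< (partner<a j))

  pairedRight : ∀ i → ∃ λ j → paired i j ≡ true
  pairedRight i = fromℕ< i<b , paired-≡ (begin
      toℕ i                      ≡⟨ m≤n⇒m⊓n≡m (s≤s⁻¹ (FP.toℕ<n i)) ⟨
      toℕ i ⊓ suc a₁             ≡⟨ cong (_⊓ suc a₁) (FP.toℕ-fromℕ< i<b) ⟨
      partner (fromℕ< i<b)       ∎)
    where
    open ≡-Reasoning
    i<b = <-≤-trans (FP.toℕ<n i) a≤b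

  unpairedLeft : ∀ j → ∃ λ i → paired i j ≡ false
  unpairedLeft j with partner j
  ... | zero  = F.suc F.zero , refl
  ... | suc _ = F.zero , refl

  unpairedRight : ∀ i → ∃ λ j → paired i j ≡ false
  unpairedRight F.zero    = F.suc F.zero , refl
  unpairedRight (F.suc i) = F.zero , refl

  pairedAt : Fin a ⊎ Fin b → Fin a ⊎ Fin b → Bool
  pairedAt (inj₁ i) (inj₂ j) = paired i j
  pairedAt (inj₂ j) (inj₁ i) = paired i j
  pairedAt _        _        = false

  pairedAt-sym : ∀ x y → pairedAt x y ≡ pairedAt y x
  pairedAt-sym (inj₁ i) (inj₁ i') = refl
  pairedAt-sym (inj₁ i) (inj₂ j)  = refl
  pairedAt-sym (inj₂ j) (inj₁ i)  = refl
  pairedAt-sym (inj₂ j) (inj₂ j') = refl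

  removed : Fin (a + b) → Fin (a + b) → Bool
  removed x y = pairedAt (splitAt a x) (splitAt a y)

  removed-sym : ∀ x y → removed x y ≡ removed y x
  removed-sym x y = pairedAt-sym (splitAt a x) (splitAt a y)

  H₀ : SimpleGraph (a + b)
  H₀ = removeEdges (K a b) removed removed-sym

  H₀⊆K : SpanningSubgraph H₀ (K a b)
  H₀⊆K = removeEdges-spanning (K a b) removed removed-sym

  H₀-adj : ∀ i j → adj H₀ (i ↑ˡ b) (a ↑ʳ j) ≡ not (paired i j)
  H₀-adj i j rewrite K-adj-↑ˡ-↑ʳ {a} {b} i j | FP.splitAt-↑ˡ a i b | FP.splitAt-↑ʳ a b j = refl

  H₀-adj′ : ∀ i j → adj H₀ (a ↑ʳ j) (i ↑ˡ b) ≡ not (paired i j)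
  H₀-adj′ i j = trans (SimpleGraph.sym H₀ (a ↑ʳ j) (i ↑ˡ b)) (H₀-adj i j)

  H₀-noIsolated : NoIsolated H₀
  H₀-noIsolated v with part a b v
  ... | left i  = let j , u = unpairedRight i in a ↑ʳ j , trans (H₀-adj i j) (cong not u)
  ... | right j = let i , u = unpairedLeft j in i ↑ˡ b , trans (H₀-adj′ i j) (cong not u)

  K-crossing = subgraphK-crossing {a} {b} (K a b) (λ _ _ e → e)

  H₀-nonNeighbour : ∀ y → ∃ λ x → side {a} {b} x ≡ not (side {a} {b} y) × adj H₀ x y ≡ false
  H₀-nonNeighbour y with part a b y
  ... | left i  = let j , p = pairedRight i in
    a ↑ʳ j , K-crossing (i ↑ˡ b) (a ↑ʳ j) (K-adj-↑ˡ-↑ʳ i j) , trans (H₀-adj′ i j) (cong not p)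
  ... | right j = let i , p = pairedLeft j in
    i ↑ˡ b , K-crossing (a ↑ʳ j) (i ↑ˡ b) (K-adj-↑ʳ-↑ˡ i j) , trans (H₀-adj i j) (cong not p)

  open Bipartite H₀ (side {a} {b}) (subgraphK-crossing {a} {b} H₀ H₀⊆K) H₀-nonNeighbour

  H₀-candidate : KBondageCandidate (K a b) 2 2 H₀
  H₀-candidate = H₀⊆K , H₀-noIsolated ,
    λ { γ ((S , dom , ∣S∣≡γ) , _) → subst (4 ≤_) ∣S∣≡γ (4≤∣totalDominating∣ F.zero S dom) }

  deletedEdges-H₀ : deletedEdges (K a b) H₀ ≡ b
  deletedEdges-H₀ = begin
    deletedEdges (K a b) H₀
      ≡⟨ deletedEdges-K H₀ H₀⊆K ⟩
    sumFin a (λ i → sumFin b (nonEdge H₀ i))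
      ≡⟨ sumFin-cong a (λ i → sumFin-cong b (λ j →
           cong boolℕ (trans (cong not (H₀-adj i j)) (not-involutive (paired i j))))) ⟩
    sumFin a (λ i → sumFin b (λ j → boolℕ (paired i j)))
      ≡⟨ sumFin-comm a b (λ i j → boolℕ (paired i j)) ⟩
    sumFin b (λ j → sumFin a (λ i → boolℕ (paired i j)))
      ≡⟨ sumFin-cong b (λ j → sumFin-toℕ≡ᵇ a (partner j) (partner<a j)) ⟩
    sumFin b (λ _ → 1)
      ≡⟨ trans (sumFin-const b 1) (*-identityʳ b) ⟩
    b ∎
    where open ≡-Reasoning

theorem3p20 : (a b : ℕ) → 2 ≤ a → a ≤ b → b ≤ 2 * a →
    IsKTotalBondageNumber (K a b) 2 b
theorem3p20 (suc (suc a₁)) (suc (suc b₁)) _ a≤b b≤2a =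
  2 , γt-K {a} {b} F.zero F.zero ,
  (H₀ , H₀-candidate , deletedEdges-H₀) ,
  bondage-lower {a} {b} b≤2a
  where open Construction a₁ b₁ a≤b
theorem3p20 (suc (suc _)) (suc zero) _ (s≤s ()) _
theorem3p20 (suc (suc _)) zero       _ ()       _
theorem3p20 (suc zero)    _          (s≤s ()) _ _
theorem3p20 zero          _          ()       _ _
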